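{- For all natural numbers $m\neq n$, $pr^{m+2}(a_0)\cap pr^{n+2}(a_0)=\emptyset$.
   Context: Work in ZFA, i.e. ZF with a set $A$ of atoms. Fix a preorder $\preccurlyeq$ on $A$ with no minimal elements: for every $a\in A$ there is $b\in A$ with $b\preccurlyeq a$ and $a\not\preccurlyeq b$. For $a\in A$ let $pr(a)=\{b\in A:b\preccurlyeq a\}$. Define the magmatic hierarchy: $M_1$ is the set of nonempty subsets $x\subseteq A$ that are downward closed ($a\in x$ and $b\preccurlyeq a$ imply $b\in x$); for $\alpha\geq 1$, $M_{\alpha+1}$ is the set of nonempty $x\subseteq M_\alpha$ such that for every $y\in x$, every $z\in M_\alpha$ with $z\subseteq y$ belongs to $x$; $M_\lambda=\bigcup_{1\leq\beta<\lambda}M_\beta$ for limit $\lambda$; $M=\bigcup_{\alpha\geq1}M_\alpha$. For $x\in M$ let $pr(x)=\{y\in M:y\subseteq x\}$; $pr^k$ denotes the $k$-th iterate of $pr$. Fix an atom $a_0\in A$. (The magmas $pr^{n+2}(a_0)$, $n\in\mathbb{N}$, are the "alternative magmatic natural numbers".) -}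

module Defs where

open import Data.Nat using (ℕ; zero; suc)
open import Data.Product using (Σ; _×_; _,_)
open import Data.Sum using (_⊎_)
open import Relation.Nullary using (¬_)
open import Relation.Binary.PropositionalEquality using (_≡_)
open import Induction.WellFounded using (Acc; acc; WellFounded)
open import Level using (Lift)

-- A universe of ZFA: objects U with membership _∈_ and a predicate Atom
-- singling out the atoms (the elements of the set A of atoms).

record ZFAStructure : Set₁ where
  field
    U          : Set
    _∈_        : U → U → Set
    Atom       : U → Set
    atom-empty : ∀ {a x} → Atom a → ¬ (x ∈ a)
    ext        : ∀ {x y} → ¬ Atom x → ¬ Atom y →
                 (∀ z → (z ∈ x → z ∈ y) × (z ∈ y → z ∈ x)) → x ≡ y
    ∈-wf       : WellFounded _∈_

-- Ordinals (≥ 1) are represented by positions in a well-order: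
-- an ordinal α ≥ 1 is an element w of a well-ordered type W, where the
-- least element of W plays the role of 1.

record WellOrder : Set₁ where
  field
    W       : Set
    _<_     : W → W → Set
    <-trans : ∀ {u v w} → u < v → v < w → u < w
    <-wf    : WellFounded _<_
    <-tri   : ∀ v w → v < w ⊎ v ≡ w ⊎ w < v

module Magmatic (Z : ZFAStructure) (_≼_ : ZFAStructure.U Z → ZFAStructure.U Z → Set) where
  open ZFAStructure Z

  _⊆_ : U → U → Set
  x ⊆ y = ∀ z → z ∈ x → z ∈ y

  Nonempty : U → Set
  Nonempty x = Σ U λ z → z ∈ x

  M₁ : U → Set
  M₁ x = Nonempty x × (∀ z → z ∈ x → Atom z)
         × (∀ a b → a ∈ x → Atom b → b ≼ a → b ∈ x)

  -- M_{α+1} from (the membership predicate of) M_α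
  Next : (U → Set) → U → Set
  Next P x = Nonempty x × (∀ y → y ∈ x → P y)
             × (∀ y z → y ∈ x → P z → z ⊆ y → z ∈ x)

  module Levels (O : WellOrder) where
    open WellOrder O

    -- LevelAcc w _ x  :  x ∈ M_w, by well-founded recursion on w:
    --  * w least            : M_w = M_1
    --  * w = v + 1          : M_w = Next M_v
    --  * w limit            : M_w = ⋃_{v < w} M_v
    LevelAcc : (w : W) → Acc _<_ w → U → Set
    LevelAcc w (acc rs) x =
        ((∀ v → ¬ (v < w)) × M₁ x)
      ⊎ (Σ W λ v → Σ (v < w) λ p →
            (∀ u → u < w → ¬ (v < u)) × Next (LevelAcc v (rs p)) x)
      ⊎ ((Σ W λ v → v < w) × (∀ v → v < w → Σ W λ u → v < u × u < w)
            × (Σ W λ v → Σ (v < w) λ p → LevelAcc v (rs p) x))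

    Level : W → U → Set
    Level w = LevelAcc w (<-wf w)

  InM : U → Set₁
  InM x = Σ WellOrder λ O → Σ (WellOrder.W O) λ w → Levels.Level O w x

  -- Pr a₀ k  is the membership predicate of pr^{k+1}(a₀):
  --   pr(a₀) = {b ∈ A : b ≼ a₀},  pr(x) = {y ∈ M : y ⊆ x}
  Pr : U → ℕ → U → Set₁
  Pr a₀ zero    y = Lift _ (Atom y × y ≼ a₀)
  Pr a₀ (suc k) y = InM y × (∀ z → z ∈ y → Pr a₀ k z)

{-# OPTIONS --safe #-}
module Submission where

-- Every magma is nonempty, whereas atoms have no elements.  Given a common
-- element of pr^{m+1}(a₀) and pr^{n+1}(a₀) with m < n, descend m times along ∈:
-- the object reached is an atom of pr(a₀) and at the same time a magma.

open import Defs
open import Data.Nat using (ℕ; suc; zero)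
open import Data.Nat.Properties using (suc-injective)
open import Data.Product using (Σ; _×_; _,_; proj₁)
open import Data.Sum using (inj₁; inj₂)
open import Function using (_∘_)
open import Relation.Nullary using (¬_)
open import Relation.Binary.PropositionalEquality using (_≢_; refl; cong)
open import Induction.WellFounded using (Acc; acc)
open import Level using (lower)

module MagmaDepth (Z : ZFAStructure) (_≼_ : ZFAStructure.U Z → ZFAStructure.U Z → Set) where
  open ZFAStructure Z
  open Magmatic Z _≼_

  nonempty⇒¬Atom : ∀ {x} → Nonempty x → ¬ Atom x
  nonempty⇒¬Atom (z , z∈x) x-atom = atom-empty x-atom z∈x

  module _ (O : WellOrder) where
    open WellOrder O
    open Levels O

    levelAcc-nonempty : ∀ w (rec : Acc _<_ w) {x} → LevelAcc w rec x → Nonempty x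
    levelAcc-nonempty w (acc rs) (inj₁ (_ , x≠∅ , _))                   = x≠∅
    levelAcc-nonempty w (acc rs) (inj₂ (inj₁ (_ , _ , _ , x≠∅ , _)))    = x≠∅
    levelAcc-nonempty w (acc rs) (inj₂ (inj₂ (_ , _ , v , v<w , x∈Mv))) =
      levelAcc-nonempty v (rs v<w) x∈Mv

  inM-nonempty : ∀ {x} → InM x → Nonempty x
  inM-nonempty (O , w , x∈Mw) = levelAcc-nonempty O w (WellOrder.<-wf O w) x∈Mw

  module _ (a₀ : U) where

    pr-zero-suc-disjoint : ∀ {n x} → Pr a₀ zero x → ¬ Pr a₀ (suc n) x
    pr-zero-suc-disjoint x∈pr (x∈M , _) =
      nonempty⇒¬Atom (inM-nonempty x∈M) (proj₁ (lower x∈pr))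

    pr-disjoint : ∀ {m n x} → m ≢ n → Pr a₀ m x → ¬ Pr a₀ n x
    pr-disjoint {zero}  {zero}  m≢n _ _ = m≢n refl
    pr-disjoint {zero}  {suc n} _ x∈pr⁰ x∈prⁿ = pr-zero-suc-disjoint x∈pr⁰ x∈prⁿ
    pr-disjoint {suc m} {zero}  _ x∈prᵐ x∈pr⁰ = pr-zero-suc-disjoint x∈pr⁰ x∈prᵐ
    pr-disjoint {suc m} {suc n} m≢n (x∈M , x⊆prᵐ) (_ , x⊆prⁿ)
      with z , z∈x ← inM-nonempty x∈M =
      pr-disjoint (m≢n ∘ cong suc) (x⊆prᵐ z z∈x) (x⊆prⁿ z z∈x)

fact5p2 : (Z : ZFAStructure) (_≼_ : ZFAStructure.U Z → ZFAStructure.U Z → Set) →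
          (∀ a → ZFAStructure.Atom Z a → a ≼ a) →
          (∀ a b c → ZFAStructure.Atom Z a → ZFAStructure.Atom Z b → ZFAStructure.Atom Z c → a ≼ b → b ≼ c → a ≼ c) →
          (∀ a → ZFAStructure.Atom Z a → Σ (ZFAStructure.U Z) λ b → ZFAStructure.Atom Z b × b ≼ a × ¬ (a ≼ b)) →
          (a₀ : ZFAStructure.U Z) → ZFAStructure.Atom Z a₀ →
          (m n : ℕ) → m ≢ n →
          ¬ (Σ (ZFAStructure.U Z) λ x → Magmatic.Pr Z _≼_ a₀ (suc m) x × Magmatic.Pr Z _≼_ a₀ (suc n) x)
fact5p2 Z _≼_ _ _ _ a₀ _ m n m≢n (x , x∈prᵐ , x∈prⁿ) =
  MagmaDepth.pr-disjoint Z _≼_ a₀ (m≢n ∘ suc-injective) x∈prᵐ x∈prⁿ
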